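{- The variety $\mathbf{DM_1}$ of De Morgan semi-Heyting algebras of level $1$ coincides with the variety $\mathbf{DMSt_1}$ of De Morgan semi-Heyting algebras of level $1$ satisfying the Stone identity $x^*\vee x^{**}\approx 1$. In particular, the variety $\mathbf{DMH_1}$ of De Morgan Heyting algebras of level $1$ coincides with the variety $\mathbf{DMStH_1}$ of De Morgan Heyting algebras of level $1$ satisfying the Stone identity.
   Context: A semi-Heyting algebra is an algebra $\langle L,\vee,\wedge,\to,0,1\rangle$ such that $\langle L,\vee,\wedge,0,1\rangle$ is a bounded lattice and the identities $x\wedge(x\to y)\approx x\wedge y$, $x\wedge(y\to z)\approx x\wedge[(x\wedge y)\to(x\wedge z)]$, and $x\to x\approx 1$ hold; $x^* := x\to 0$. It is a Heyting algebra if additionally $(x\wedge y)\to y\approx 1$. A dually quasi-De Morgan semi-Heyting algebra is an algebra $\langle L,\vee,\wedge,\to,{}',0,1\rangle$ whose reduct $\langle L,\vee,\wedge,\to,0,1\rangle$ is a semi-Heyting algebra and which satisfies $0'\approx 1$, $1'\approx 0$, $(x\wedge y)'\approx x'\vee y'$, $(x\vee y)''\approx x''\vee y''$, and $x''\le x$. A De Morgan semi-Heyting algebra is such an algebra satisfying $x''\approx x$; it is a De Morgan Heyting algebra if its semi-Heyting reduct is a Heyting algebra. Define $x^{0('^*)} := x$, $x^{(k+1)('^*)} := ((x^{k('^*)})')^*$, $t_0(x):=x$, $t_{k+1}(x):=t_k(x)\wedge x^{(k+1)('^*)}$. Level $1$ means the identity $t_1(x)\approx t_2(x)$ holds. -}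

module Defs where

open import Level using (Level)
open import Data.Nat using (ℕ; zero; suc)
open import Data.Product using (_×_)
open import Relation.Binary.PropositionalEquality using (_≡_)
open import Algebra.Core using (Op₁; Op₂)
open import Algebra.Lattice.Structures using (IsLattice)

record DMSH (a : Level) : Set (Level.suc a) where
  infixr 6 _∨_
  infixr 7 _∧_
  infixr 5 _⇒_
  field
    Carrier : Set a
    _∨_ _∧_ _⇒_ : Op₂ Carrier
    _′ : Op₁ Carrier
    𝟎 𝟏 : Carrier
    isLattice : IsLattice {A = Carrier} _≡_ _∨_ _∧_
    𝟎-least : ∀ x → 𝟎 ∧ x ≡ 𝟎
    𝟏-greatest : ∀ x → 𝟏 ∧ x ≡ x
    sh1 : ∀ x y → x ∧ (x ⇒ y) ≡ x ∧ y
    sh2 : ∀ x y z → x ∧ (y ⇒ z) ≡ x ∧ ((x ∧ y) ⇒ (x ∧ z))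
    sh3 : ∀ x → x ⇒ x ≡ 𝟏
    dq1 : 𝟎 ′ ≡ 𝟏
    dq2 : 𝟏 ′ ≡ 𝟎
    dq3 : ∀ x y → (x ∧ y) ′ ≡ (x ′) ∨ (y ′)
    dq4 : ∀ x y → ((x ∨ y) ′) ′ ≡ ((x ′) ′) ∨ ((y ′) ′)
    dq5 : ∀ x → ((x ′) ′) ∧ x ≡ (x ′) ′
    dm : ∀ x → (x ′) ′ ≡ x

  _* : Op₁ Carrier
  x * = x ⇒ 𝟎

  iter : ℕ → Op₁ Carrier
  iter zero x = x
  iter (suc k) x = ((iter k x) ′) *

  t : ℕ → Op₁ Carrier
  t zero x = x
  t (suc k) x = t k x ∧ iter (suc k) x

module _ {a : Level} (A : DMSH a) where
  open DMSH A

  Level1 : Set a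
  Level1 = ∀ x → t 1 x ≡ t 2 x

  IsHeyting : Set a
  IsHeyting = ∀ x y → (x ∧ y) ⇒ y ≡ 𝟏

  Stone : Set a
  Stone = ∀ x → (x *) ∨ ((x *) *) ≡ 𝟏

module Submission where

-- Level 1 is the only hypothesis needed.
-- In any semi-Heyting algebra, x* := x → 0 is a pseudocomplement: y ∧ x = 0
-- forces y ≤ x*, hence x ≤ x** and x*** = x*.  Level 1 says w ∧ w′* ≤ (w′*)′*;
-- since (w′*)′* is disjoint from (w′*)′, the element w ∧ w′* ∧ (w′*)′ is 0.
-- Putting w := y′ and using y″ = y gives the key fact  y′ ∧ y* ∧ y*′ = 0.
-- For z := x*′ ∧ x**′ = (x* ∨ x**)′ the key fact at y := x* gives z ∧ x** = 0
-- and at y := x** (with x*** = x*) gives z ∧ x* = 0, so z ≤ x** and therefore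
-- z = 0.  Finally x* ∨ x** = (x* ∨ x**)″ = 0′ = 1, which is the Stone identity.

open import Defs
open import Level using (Level)
open import Data.Product using (_×_; _,_; proj₁)
open import Function.Bundles using (_⇔_; mk⇔)
open import Relation.Binary.PropositionalEquality
  using (_≡_; sym; trans; cong; cong₂; subst; module ≡-Reasoning)
open import Algebra.Lattice.Structures using (IsLattice)

module Properties {a : Level} (A : DMSH a) where
  open DMSH A
  open IsLattice isLattice using (∧-comm; ∧-assoc)
  open ≡-Reasoning

  infix 4 _≤_
  _≤_ : Carrier → Carrier → Set a
  x ≤ y = x ∧ y ≡ x

  x∧𝟎≡𝟎 : ∀ x → x ∧ 𝟎 ≡ 𝟎
  x∧𝟎≡𝟎 x = trans (∧-comm x 𝟎) (𝟎-least x)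

  x∧𝟏≡x : ∀ x → x ∧ 𝟏 ≡ x
  x∧𝟏≡x x = trans (∧-comm x 𝟏) (𝟏-greatest x)

  ∧-swapʳ : ∀ p q r → (p ∧ q) ∧ r ≡ (p ∧ r) ∧ q
  ∧-swapʳ p q r = trans (∧-assoc p q r) (trans (cong (p ∧_) (∧-comm q r)) (sym (∧-assoc p r q)))

  ∧-rotate : ∀ p q r → (p ∧ q) ∧ r ≡ q ∧ (r ∧ p)
  ∧-rotate p q r = trans (∧-assoc p q r) (trans (∧-comm p (q ∧ r)) (∧-assoc q r p))

  x∧x*≡𝟎 : ∀ x → x ∧ x * ≡ 𝟎
  x∧x*≡𝟎 x = trans (sh1 x 𝟎) (x∧𝟎≡𝟎 x)

  disjoint⇒≤* : ∀ x y → x ∧ y ≡ 𝟎 → y ≤ x *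
  disjoint⇒≤* x y x∧y≡𝟎 = begin
    y ∧ (x ⇒ 𝟎)             ≡⟨ sh2 y x 𝟎 ⟩
    y ∧ ((y ∧ x) ⇒ (y ∧ 𝟎)) ≡⟨ cong₂ (λ u v → y ∧ (u ⇒ v)) (trans (∧-comm y x) x∧y≡𝟎) (x∧𝟎≡𝟎 y) ⟩
    y ∧ (𝟎 ⇒ 𝟎)             ≡⟨ cong (y ∧_) (sh3 𝟎) ⟩
    y ∧ 𝟏                   ≡⟨ x∧𝟏≡x y ⟩
    y                       ∎

  x≤x** : ∀ x → x ≤ (x *) *
  x≤x** x = disjoint⇒≤* (x *) x (trans (∧-comm (x *) x) (x∧x*≡𝟎 x))

  *-antitone : ∀ p q → p ≤ q → q * ≤ p *
  *-antitone p q p≤q = disjoint⇒≤* p (q *) (begin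
    p ∧ q *       ≡⟨ cong (_∧ q *) (sym p≤q) ⟩
    (p ∧ q) ∧ q * ≡⟨ ∧-assoc p q (q *) ⟩
    p ∧ (q ∧ q *) ≡⟨ cong (p ∧_) (x∧x*≡𝟎 q) ⟩
    p ∧ 𝟎         ≡⟨ x∧𝟎≡𝟎 p ⟩
    𝟎             ∎)

  x***≡x* : ∀ x → ((x *) *) * ≡ x *
  x***≡x* x = begin
    ((x *) *) *         ≡⟨ sym (*-antitone x ((x *) *) (x≤x** x)) ⟩
    ((x *) *) * ∧ x *   ≡⟨ ∧-comm _ _ ⟩
    x * ∧ ((x *) *) *   ≡⟨ x≤x** (x *) ⟩
    x *                 ∎

  ′-∨ : ∀ p q → (p ∨ q) ′ ≡ p ′ ∧ q ′
  ′-∨ p q = begin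
    (p ∨ q) ′           ≡⟨ cong _′ (sym (trans (dq3 (p ′) (q ′)) (cong₂ _∨_ (dm p) (dm q)))) ⟩
    ((p ′ ∧ q ′) ′) ′   ≡⟨ dm _ ⟩
    p ′ ∧ q ′           ∎

  ′≡𝟎⇒≡𝟏 : ∀ p → p ′ ≡ 𝟎 → p ≡ 𝟏
  ′≡𝟎⇒≡𝟏 p p′≡𝟎 = trans (sym (dm p)) (trans (cong _′ p′≡𝟎) dq1)

  -- Level 1 forces w ∧ w′* to be disjoint from (w′*)′, because it lies below
  -- (w′*)′*, the pseudocomplement of (w′*)′.
  level1-disjoint : Level1 A → ∀ w → (w ∧ (w ′) *) ∧ ((w ′) *) ′ ≡ 𝟎
  level1-disjoint level1 w = begin
    (w ∧ u) ∧ u ′                ≡⟨ cong (_∧ u ′) (level1 w) ⟩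
    ((w ∧ u) ∧ (u ′) *) ∧ u ′    ≡⟨ ∧-assoc _ _ _ ⟩
    (w ∧ u) ∧ ((u ′) * ∧ u ′)    ≡⟨ cong ((w ∧ u) ∧_) (trans (∧-comm _ _) (x∧x*≡𝟎 (u ′))) ⟩
    (w ∧ u) ∧ 𝟎                  ≡⟨ x∧𝟎≡𝟎 _ ⟩
    𝟎                            ∎
    where u = (w ′) *

  level1-key : Level1 A → ∀ y → (y ′ ∧ y *) ∧ (y *) ′ ≡ 𝟎
  level1-key level1 y = subst (λ v → (y ′ ∧ v *) ∧ (v *) ′ ≡ 𝟎) (dm y) (level1-disjoint level1 (y ′))

  level1⇒stone : Level1 A → Stone A
  level1⇒stone level1 x = ′≡𝟎⇒≡𝟏 (x * ∨ x**) (trans (′-∨ (x *) x**) z≡𝟎)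
    where
    x** = (x *) *
    z   = (x *) ′ ∧ x** ′
    z∧x**≡𝟎 : z ∧ x** ≡ 𝟎
    z∧x**≡𝟎 = trans (∧-swapʳ _ _ _) (level1-key level1 (x *))
    x*∧z≡𝟎 : x * ∧ z ≡ 𝟎
    x*∧z≡𝟎 = trans (sym (∧-rotate _ _ _))
               (subst (λ v → (x** ′ ∧ v) ∧ v ′ ≡ 𝟎) (x***≡x* x) (level1-key level1 x**))
    z≡𝟎 : z ≡ 𝟎
    z≡𝟎 = trans (sym (disjoint⇒≤* (x *) z x*∧z≡𝟎)) z∧x**≡𝟎

corollary3p4 : ∀ {a : Level} →
    ((A : DMSH a) → Level1 A ⇔ (Level1 A × Stone A))
    × ((A : DMSH a) → IsHeyting A → Level1 A ⇔ (Level1 A × Stone A))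
corollary3p4 = level1⇔level1×stone , λ A _ → level1⇔level1×stone A
  where
  level1⇔level1×stone : ∀ {a} (A : DMSH a) → Level1 A ⇔ (Level1 A × Stone A)
  level1⇔level1×stone A = mk⇔ (λ level1 → level1 , Properties.level1⇒stone A level1) proj₁
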